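{- Let $n\ge 3$, let $\mathbb{D}^{t}_{n}$ be the Prism allied graph and let $P=\{p_i : 1\le i\le n\}$. If $M$ is any mixed metric generator of $\mathbb{D}^{t}_{n}$, then $P\cap M\neq\emptyset$.
   Context: For an integer $n\ge 3$, the Prism allied graph $\mathbb{D}^{t}_{n}$ has vertex set $\{p_i,q_i,r_i,s_i : 1\le i\le n\}$ and edge set $\{p_iq_i,\ p_ip_{i+1},\ q_iq_{i+1},\ r_iq_i,\ r_iq_{i+1},\ r_is_i : 1\le i\le n\}$, with indices taken modulo $n$. For a connected graph $H$, $d_H(u,v)$ is the shortest-path distance, and for a vertex $x$ and an edge $e=uv$, $d_H(x,e)=\min\{d_H(x,u),d_H(x,v)\}$. A set $M\subseteq V(H)$ is a mixed metric generator of $H$ if for every two distinct elements $y_1,y_2\in V(H)\cup E(H)$ there is a vertex $z\in M$ with $d_H(z,y_1)\ne d_H(z,y_2)$. -}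

module Defs where

open import Data.Nat using (ℕ; zero; suc; _≤_; _⊓_)
open import Data.Nat.DivMod using (_mod_)
open import Data.Fin using (Fin; toℕ)
open import Data.Product using (_×_; Σ; ∃; _,_)
open import Data.Sum using (_⊎_)
open import Data.Bool using (Bool; true)
open import Relation.Binary.PropositionalEquality using (_≡_; _≢_)

-- successor of an index modulo n (indices 1..n of the paper are Fin n here)
sucMod : ∀ {n} → Fin n → Fin n
sucMod {suc m} i = suc (toℕ i) mod (suc m)

data Kind : Set where
  p q r s : Kind

Vertex : ℕ → Set
Vertex n = Kind × Fin n

data EKind : Set where
  pq pp qq rq rq' rs : EKind

Edge : ℕ → Set
Edge n = EKind × Fin n

ends : ∀ {n} → Edge n → Vertex n × Vertex n
ends (pq  , i) = (p , i) , (q , i)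
ends (pp  , i) = (p , i) , (p , sucMod i)
ends (qq  , i) = (q , i) , (q , sucMod i)
ends (rq  , i) = (r , i) , (q , i)
ends (rq' , i) = (r , i) , (q , sucMod i)
ends (rs  , i) = (r , i) , (s , i)

data Adj {n : ℕ} : Vertex n → Vertex n → Set where
  fwd : (e : Edge n) → Adj (Data.Product.proj₁ (ends e)) (Data.Product.proj₂ (ends e))
  bwd : (e : Edge n) → Adj (Data.Product.proj₂ (ends e)) (Data.Product.proj₁ (ends e))

data Walk {n : ℕ} : Vertex n → Vertex n → ℕ → Set where
  here : ∀ {u} → Walk u u 0
  step : ∀ {u w v k} → Adj u w → Walk w v k → Walk u v (suc k)

DistV : ∀ {n} → Vertex n → Vertex n → ℕ → Set
DistV u v k = Walk u v k × (∀ m → Walk u v m → k ≤ m)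

Elem : ℕ → Set
Elem n = Vertex n ⊎ Edge n

Dist : ∀ {n} → Vertex n → Elem n → ℕ → Set
Dist x (Data.Sum.inj₁ v) k = DistV x v k
Dist x (Data.Sum.inj₂ e) k =
  Σ ℕ λ a → Σ ℕ λ b →
    DistV x (Data.Product.proj₁ (ends e)) a ×
    DistV x (Data.Product.proj₂ (ends e)) b × k ≡ a ⊓ b

IsMixedMetricGenerator : ∀ {n} → (Vertex n → Bool) → Set
IsMixedMetricGenerator {n} M =
  (y₁ y₂ : Elem n) → y₁ ≢ y₂ →
  Σ (Vertex n) λ z → M z ≡ true ×
    (Σ ℕ λ a → Σ ℕ λ b → Dist z y₁ a × Dist z y₂ b × a ≢ b)

-- Collapsing every p_i onto q_i maps edges to edges or loops, so it never lengthens a walk and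
-- fixes every vertex outside P. Hence a vertex z ∉ P is at least as close to q_1 as to p_1, so
-- d(z, q_1) = d(z, p_1 q_1) and the pair (q_1, p_1 q_1) can only be resolved by a vertex of P.
{-# OPTIONS --safe #-}
module Submission where

open import Defs
open import Data.Nat using (ℕ; _≤_; suc; s≤s; z≤n)
open import Data.Nat.Properties using (≤-trans; ≤-antisym; n≤1+n; m≥n⇒m⊓n≡n)
open import Data.Fin using (Fin)
open import Data.Product using (Σ; _,_; _×_)
open import Data.Sum using (_⊎_; inj₁; inj₂)
open import Data.Bool using (Bool; true)
open import Data.Empty using (⊥-elim)
open import Relation.Binary.PropositionalEquality using (_≡_; refl; sym; trans; subst)

collapse : ∀ {n} → Vertex n → Vertex n
collapse (p , i) = q , i
collapse (k , i) = k , i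

collapse-Adj : ∀ {n} {u w : Vertex n} → Adj u w → collapse u ≡ collapse w ⊎ Adj (collapse u) (collapse w)
collapse-Adj (fwd (pq  , i)) = inj₁ refl
collapse-Adj (fwd (pp  , i)) = inj₂ (fwd (qq , i))
collapse-Adj (fwd (qq  , i)) = inj₂ (fwd (qq , i))
collapse-Adj (fwd (rq  , i)) = inj₂ (fwd (rq , i))
collapse-Adj (fwd (rq' , i)) = inj₂ (fwd (rq' , i))
collapse-Adj (fwd (rs  , i)) = inj₂ (fwd (rs , i))
collapse-Adj (bwd (pq  , i)) = inj₁ refl
collapse-Adj (bwd (pp  , i)) = inj₂ (bwd (qq , i))
collapse-Adj (bwd (qq  , i)) = inj₂ (bwd (qq , i))
collapse-Adj (bwd (rq  , i)) = inj₂ (bwd (rq , i))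
collapse-Adj (bwd (rq' , i)) = inj₂ (bwd (rq' , i))
collapse-Adj (bwd (rs  , i)) = inj₂ (bwd (rs , i))

collapse-Walk : ∀ {n} {u v : Vertex n} {k} → Walk u v k →
  Σ ℕ λ m → m ≤ k × Walk (collapse u) (collapse v) m
collapse-Walk here = 0 , z≤n , here
collapse-Walk (step a w) with collapse-Walk w | collapse-Adj a
... | m , m≤k , w′ | inj₁ eq = m , ≤-trans m≤k (n≤1+n _) , subst (λ x → Walk x _ m) (sym eq) w′
... | m , m≤k , w′ | inj₂ a′ = suc m , s≤s m≤k , step a′ w′

DistV-unique : ∀ {n} {u v : Vertex n} {a b} → DistV u v a → DistV u v b → a ≡ b
DistV-unique (wa , min-a) (wb , min-b) = ≤-antisym (min-a _ wb) (min-b _ wa)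

DistV-q≤DistV-p : ∀ {n} {z : Vertex n} {i a b} → collapse z ≡ z →
  DistV z (q , i) a → DistV z (p , i) b → a ≤ b
DistV-q≤DistV-p {i = i} fixed (_ , min-q) (w , _) with collapse-Walk w
... | m , m≤b , w′ = ≤-trans (min-q m (subst (λ x → Walk x (q , i) m) fixed w′)) m≤b

Dist-pq≡DistV-q : ∀ {n} {z : Vertex n} {i a b} → collapse z ≡ z →
  DistV z (q , i) a → Dist z (inj₂ (pq , i)) b → a ≡ b
Dist-pq≡DistV-q fixed dq (a′ , b′ , dp , dq′ , b≡a′⊓b′) =
  trans (DistV-unique dq dq′)
        (sym (trans b≡a′⊓b′ (m≥n⇒m⊓n≡n (DistV-q≤DistV-p fixed dq′ dp))))

lemma2 : (n : ℕ) → 3 ≤ n → (M : Vertex n → Bool) →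
    IsMixedMetricGenerator M → Σ (Fin n) λ i → M (p , i) ≡ true
lemma2 (suc _) (s≤s _) M generator
  with generator (inj₁ (q , Fin.zero)) (inj₂ (pq , Fin.zero)) (λ ())
... | (p , i) , i∈M , _ = i , i∈M
... | (q , _) , _ , _ , _ , dq , dpq , a≢b = ⊥-elim (a≢b (Dist-pq≡DistV-q refl dq dpq))
... | (r , _) , _ , _ , _ , dq , dpq , a≢b = ⊥-elim (a≢b (Dist-pq≡DistV-q refl dq dpq))
... | (s , _) , _ , _ , _ , dq , dpq , a≢b = ⊥-elim (a≢b (Dist-pq≡DistV-q refl dq dpq))
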